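{- Let $p$ be a prime and $k,N$ positive integers. For any positive integer $n\geq N$, \[ \sum_{i=0}^{\varphi(p^N)-1}B^{(-k)}_{n+i}\equiv \sum_{i=0}^{\varphi(p^N)-1}B^{(-n-i)}_{k}\equiv 0\pmod{p^N}. \]
   Context: For any integer $k$, let $\mathrm{Li}_k(t)=\sum_{n\geq 1} t^n/n^k$ (for $k\le 0$ this is a rational function of $t$). The poly-Bernoulli numbers $B^{(k)}_n$ ($n\geq 0$) are defined by \[ \frac{\mathrm{Li}_{k}(1-e^{ -t})}{1-e^{ -t}}=\sum_{n=0}^{\infty}B^{(k)}_{n}\frac{t^n}{n!}. \] For negative upper index these are positive integers. $\varphi$ denotes Euler's totient function, so $\varphi(p^N)=p^{N-1}(p-1)$. -}

module Defs where

open import Data.Nat as ℕ using (ℕ; zero; suc; _∸_)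
open import Data.Nat.Combinatorics using (_C_)
open import Data.Integer as ℤ using (ℤ; +_; -_; _+_; _*_; _^_)

sumBelow : ℕ → (ℕ → ℤ) → ℤ
sumBelow zero    f = + 0
sumBelow (suc n) f = sumBelow n f + f n

-- Formal power series represented in the exponential basis:
-- a sequence a represents  Σ_n a n · t^n / n!.
EGF : Set
EGF = ℕ → ℤ

egfMul : EGF → EGF → EGF
egfMul a b n = sumBelow (suc n) (λ i → (+ (n C i)) * a i * b (n ∸ i))

egfOne : EGF
egfOne zero    = + 1
egfOne (suc _) = + 0

egfPow : EGF → ℕ → EGF
egfPow a zero    = egfOne
egfPow a (suc m) = egfMul a (egfPow a m)

-- The series x(t) = 1 - e^{-t} = Σ_{j≥1} (-1)^{j+1} t^j / j!.
oneMinusExpNeg : EGF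
oneMinusExpNeg zero    = + 0
oneMinusExpNeg (suc j) = (- (+ 1)) ^ j

-- For k ≥ 0,  Li_{-k}(x)/x = Σ_{m≥0} (m+1)^k x^m.  Substituting
-- x = 1 - e^{-t} (which has zero constant term, so x^m = O(t^m)),
-- the coefficient of t^n/n! only receives contributions from m ≤ n.
-- polyBernoulliNeg k n  =  B_n^{(-k)}  =  n! [t^n] Li_{-k}(1-e^{-t})/(1-e^{-t}).
polyBernoulliNeg : ℕ → ℕ → ℤ
polyBernoulliNeg k n =
  sumBelow (suc n) (λ m → ((+ (suc m)) ^ k) * egfPow oneMinusExpNeg m n)

-- Euler's totient at a prime power: φ(p^N) = p^(N-1) (p-1)  (N ≥ 1).
φPrimePow : ℕ → ℕ → ℕ
φPrimePow p N = p ℕ.^ (N ∸ 1) ℕ.* (p ∸ 1)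

{-# OPTIONS --safe #-}

-- Write x = 1 - e^{-t} and c(m,n) = n! [t^n] x^m, so that B_n^{(-k)} = Σ_m (m+1)^k c(m,n).
-- Since x' = 1 - x, the Leibniz rule gives c(m+1,n+1) = (m+1) (c(m,n) - c(m+1,n)).  This
-- recurrence yields Σ_m C(m,j) c(m,n) = T(n,j), where T(k,j) = j! S(k+1,j+1) also satisfies
-- (m+1)^k = Σ_j C(m,j) T(k,j); hence B_n^{(-k)} = Σ_j T(k,j) T(n,j) is symmetric in n and k,
-- and the first congruence reduces to the second.  For the second, Σ_i B_k^{(-n-i)} = Σ_m c(m,k) s_m with
-- s_m = Σ_{i<φ(p^N)} (m+1)^{n+i}.  For k ≥ 1 the recurrence shows m ∣ c(m,k), and
-- m s_m = (m+1)^n ((m+1)^φ(p^N) - 1) is divisible by p^N: through (m+1)^n if p ∣ m+1 (as n ≥ N),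
-- and by Euler's theorem otherwise, which follows from Fermat's little theorem by lifting
-- p ∣ d ∣ y - 1 to d p ∣ y^p - 1.
module Submission where

open import Data.Empty using (⊥-elim)
open import Data.Product using (_×_; _,_)
open import Data.Sum using (inj₁; inj₂; fromInj₂)
open import Function using (_∘_)
open import Relation.Nullary using (¬_; yes; no)
open import Relation.Binary.PropositionalEquality

open import Data.Nat as ℕ using (ℕ; zero; suc; _∸_; z≤n; s≤s)
import Data.Nat.Properties as ℕₚ
import Data.Nat.Divisibility as ℕ∣
open import Data.Nat.Combinatorics
  using (_C_; nCn≡1; nC1≡n; k>n⇒nCk≡0; nCk+nC[k+1]≡[n+1]C[k+1])
open import Data.Nat.Primality using (Prime; euclidsLemma; ¬prime[0])
open import Data.Nat.Tactic.RingSolver using () renaming (solve-∀ to ℕ-solve-∀)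

open import Data.Integer using (ℤ; +_; -_; _+_; _*_; _-_; _^_; ∣_∣)
import Data.Integer.Properties as ℤₚ
open import Data.Integer.Divisibility using () renaming (_∣_ to _∣ᵤ_)
open import Data.Integer.Divisibility.Signed
  using (_∣_; divides; ∣ᵤ⇒∣; ∣⇒∣ᵤ; ∣-refl; ∣-trans; ∣m∣n⇒∣m+n; ∣m⇒∣m*n; ∣n⇒∣m*n;
         *-monoʳ-∣; *-monoˡ-∣)
open import Data.Integer.Tactic.RingSolver using (solve-∀)
import Algebra.Properties.CommutativeSemigroup as CommSemigroupProperties
open CommSemigroupProperties ℤₚ.+-commutativeSemigroup using (interchange; x∙yz≈y∙xz)
module *-Comm = CommSemigroupProperties ℤₚ.*-commutativeSemigroup
open import Algebra.Properties.Ring ℤₚ.+-*-ring using ([y-z]x≈yx-zx)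

open import Defs

sumBelow-cong : ∀ n {f g : ℕ → ℤ} → (∀ i → i ℕ.< n → f i ≡ g i) →
                sumBelow n f ≡ sumBelow n g
sumBelow-cong zero    f≗g = refl
sumBelow-cong (suc n) f≗g =
  cong₂ _+_ (sumBelow-cong n (λ i i<n → f≗g i (ℕₚ.m<n⇒m<1+n i<n))) (f≗g n ℕₚ.≤-refl)

sumBelow-zero : ∀ n {f : ℕ → ℤ} → (∀ i → i ℕ.< n → f i ≡ + 0) → sumBelow n f ≡ + 0
sumBelow-zero zero    f≗0 = refl
sumBelow-zero (suc n) f≗0 =
  cong₂ _+_ (sumBelow-zero n (λ i i<n → f≗0 i (ℕₚ.m<n⇒m<1+n i<n))) (f≗0 n ℕₚ.≤-refl)

sumBelow-+ : ∀ n (f g : ℕ → ℤ) →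
             sumBelow n (λ i → f i + g i) ≡ sumBelow n f + sumBelow n g
sumBelow-+ zero    f g = refl
sumBelow-+ (suc n) f g =
  trans (cong (_+ (f n + g n)) (sumBelow-+ n f g)) (interchange (sumBelow n f) (sumBelow n g) (f n) (g n))

sumBelow-neg : ∀ n (f : ℕ → ℤ) → sumBelow n (λ i → - f i) ≡ - sumBelow n f
sumBelow-neg zero    f = refl
sumBelow-neg (suc n) f =
  trans (cong (_+ - f n) (sumBelow-neg n f)) (sym (ℤₚ.neg-distrib-+ (sumBelow n f) (f n)))

sumBelow-- : ∀ n (f g : ℕ → ℤ) →
             sumBelow n (λ i → f i - g i) ≡ sumBelow n f - sumBelow n g
sumBelow-- n f g =
  trans (sumBelow-+ n f (λ i → - g i)) (cong (_+_ (sumBelow n f)) (sumBelow-neg n g))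

sumBelow-*ˡ : ∀ n (c : ℤ) (f : ℕ → ℤ) → sumBelow n (λ i → c * f i) ≡ c * sumBelow n f
sumBelow-*ˡ zero    c f = sym (ℤₚ.*-zeroʳ c)
sumBelow-*ˡ (suc n) c f =
  trans (cong (_+ c * f n) (sumBelow-*ˡ n c f)) (sym (ℤₚ.*-distribˡ-+ c (sumBelow n f) (f n)))

sumBelow-*ʳ : ∀ n (c : ℤ) (f : ℕ → ℤ) → sumBelow n (λ i → f i * c) ≡ sumBelow n f * c
sumBelow-*ʳ zero    c f = sym (ℤₚ.*-zeroˡ c)
sumBelow-*ʳ (suc n) c f =
  trans (cong (_+ f n * c) (sumBelow-*ʳ n c f)) (sym (ℤₚ.*-distribʳ-+ c (sumBelow n f) (f n)))

sumBelow-const : ∀ n (c : ℤ) → sumBelow n (λ _ → c) ≡ + n * c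
sumBelow-const zero    c = sym (ℤₚ.*-zeroˡ c)
sumBelow-const (suc n) c = begin
  sumBelow n (λ _ → c) + c ≡⟨ cong (_+ c) (sumBelow-const n c) ⟩
  + n * c + c              ≡⟨ ℤₚ.+-comm (+ n * c) c ⟩
  c + + n * c              ≡⟨ sym (ℤₚ.suc-* (+ n) c) ⟩
  + suc n * c              ∎
  where open ≡-Reasoning

sumBelow-suc : ∀ n (f : ℕ → ℤ) → sumBelow (suc n) f ≡ f 0 + sumBelow n (f ∘ suc)
sumBelow-suc zero    f = ℤₚ.+-comm (+ 0) (f 0)
sumBelow-suc (suc n) f =
  trans (cong (_+ f (suc n)) (sumBelow-suc n f)) (ℤₚ.+-assoc (f 0) _ (f (suc n)))

sumBelow-shift : ∀ n (f : ℕ → ℤ) → f 0 ≡ + 0 → f n ≡ + 0 →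
                 sumBelow n (f ∘ suc) ≡ sumBelow n f
sumBelow-shift n f f0≡0 fn≡0 = begin
  sumBelow n (f ∘ suc)         ≡⟨ sym (ℤₚ.+-identityˡ _) ⟩
  + 0 + sumBelow n (f ∘ suc)   ≡⟨ cong (_+ sumBelow n (f ∘ suc)) (sym f0≡0) ⟩
  f 0 + sumBelow n (f ∘ suc)   ≡⟨ sym (sumBelow-suc n f) ⟩
  sumBelow n f + f n           ≡⟨ cong (_+_ (sumBelow n f)) fn≡0 ⟩
  sumBelow n f + + 0           ≡⟨ ℤₚ.+-identityʳ _ ⟩
  sumBelow n f                 ∎
  where open ≡-Reasoning

sumBelow-comm : ∀ a b (f : ℕ → ℕ → ℤ) →
                sumBelow a (λ i → sumBelow b (f i)) ≡ sumBelow b (λ j → sumBelow a (λ i → f i j))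
sumBelow-comm zero    b f = sym (sumBelow-zero b (λ _ _ → refl))
sumBelow-comm (suc a) b f =
  trans (cong (_+ sumBelow b (f a)) (sumBelow-comm a b f))
        (sym (sumBelow-+ b (λ j → sumBelow a (λ i → f i j)) (f a)))

∣-sumBelow : ∀ n {d} (f : ℕ → ℤ) → (∀ i → i ℕ.< n → d ∣ f i) → d ∣ sumBelow n f
∣-sumBelow zero    f d∣f = divides (+ 0) refl
∣-sumBelow (suc n) f d∣f =
  ∣m∣n⇒∣m+n (∣-sumBelow n f (λ i i<n → d∣f i (ℕₚ.m<n⇒m<1+n i<n))) (d∣f n ℕₚ.≤-refl)

[k+1]*[n+1]C[k+1]≡[n+1]*nCk : ∀ n k → suc k ℕ.* (suc n C suc k) ≡ suc n ℕ.* (n C k)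
[k+1]*[n+1]C[k+1]≡[n+1]*nCk zero    zero    = refl
[k+1]*[n+1]C[k+1]≡[n+1]*nCk zero    (suc k)
  rewrite k>n⇒nCk≡0 {1} {suc (suc k)} (s≤s (s≤s z≤n)) | k>n⇒nCk≡0 {0} {suc k} (s≤s z≤n)
  = ℕₚ.*-zeroʳ (suc (suc k))
[k+1]*[n+1]C[k+1]≡[n+1]*nCk (suc n) zero    =
  trans (ℕₚ.+-identityʳ _) (trans (nC1≡n (suc (suc n))) (sym (ℕₚ.*-identityʳ _)))
[k+1]*[n+1]C[k+1]≡[n+1]*nCk (suc n) (suc k) = begin
  suc (suc k) ℕ.* (suc (suc n) C suc (suc k))
    ≡⟨ cong (suc (suc k) ℕ.*_) (sym (nCk+nC[k+1]≡[n+1]C[k+1] (suc n) (suc k))) ⟩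
  suc (suc k) ℕ.* (a ℕ.+ b)
    ≡⟨ regroup k a b ⟩
  (suc k ℕ.* a ℕ.+ suc (suc k) ℕ.* b) ℕ.+ a
    ≡⟨ cong (ℕ._+ a) (cong₂ ℕ._+_ ([k+1]*[n+1]C[k+1]≡[n+1]*nCk n k)
                                    ([k+1]*[n+1]C[k+1]≡[n+1]*nCk n (suc k))) ⟩
  (suc n ℕ.* (n C k) ℕ.+ suc n ℕ.* (n C suc k)) ℕ.+ a
    ≡⟨ cong (ℕ._+ a) (sym (ℕₚ.*-distribˡ-+ (suc n) (n C k) (n C suc k))) ⟩
  suc n ℕ.* (n C k ℕ.+ n C suc k) ℕ.+ a
    ≡⟨ cong (λ z → suc n ℕ.* z ℕ.+ a) (nCk+nC[k+1]≡[n+1]C[k+1] n k) ⟩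
  suc n ℕ.* a ℕ.+ a
    ≡⟨ ℕₚ.+-comm (suc n ℕ.* a) a ⟩
  suc (suc n) ℕ.* a ∎
  where
  open ≡-Reasoning
  a = suc n C suc k
  b = suc n C suc (suc k)
  regroup : ∀ k a b → suc (suc k) ℕ.* (a ℕ.+ b) ≡ (suc k ℕ.* a ℕ.+ suc (suc k) ℕ.* b) ℕ.+ a
  regroup = ℕ-solve-∀

[k+1]*[nCk+nC[k+1]]≡[n+1]*nCk : ∀ n k → suc k ℕ.* (n C k ℕ.+ n C suc k) ≡ suc n ℕ.* (n C k)
[k+1]*[nCk+nC[k+1]]≡[n+1]*nCk n k =
  trans (cong (suc k ℕ.*_) (nCk+nC[k+1]≡[n+1]C[k+1] n k)) ([k+1]*[n+1]C[k+1]≡[n+1]*nCk n k)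

[n+1]*[n+1]Ck≡[k+1]*nCk+k*nC[k-1]+n*nCk : ∀ n k →
  suc n ℕ.* (suc n C k) ≡ (suc k ℕ.* (n C k) ℕ.+ k ℕ.* (n C (k ∸ 1))) ℕ.+ n ℕ.* (n C k)
[n+1]*[n+1]Ck≡[k+1]*nCk+k*nC[k-1]+n*nCk n zero    = refl
[n+1]*[n+1]Ck≡[k+1]*nCk+k*nC[k-1]+n*nCk n (suc k) = begin
  suc n ℕ.* (suc n C suc k)
    ≡⟨ cong (suc n ℕ.*_) (sym (nCk+nC[k+1]≡[n+1]C[k+1] n k)) ⟩
  suc n ℕ.* (a ℕ.+ b)
    ≡⟨ ℕₚ.*-distribˡ-+ (suc n) a b ⟩
  suc n ℕ.* a ℕ.+ suc n ℕ.* b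
    ≡⟨ cong (ℕ._+ suc n ℕ.* b) (sym ([k+1]*[nCk+nC[k+1]]≡[n+1]*nCk n k)) ⟩
  suc k ℕ.* (a ℕ.+ b) ℕ.+ suc n ℕ.* b
    ≡⟨ regroup n k a b ⟩
  (suc (suc k) ℕ.* b ℕ.+ suc k ℕ.* a) ℕ.+ n ℕ.* b ∎
  where
  open ≡-Reasoning
  a = n C k
  b = n C suc k
  regroup : ∀ n k a b → suc k ℕ.* (a ℕ.+ b) ℕ.+ suc n ℕ.* b ≡
                        (suc (suc k) ℕ.* b ℕ.+ suc k ℕ.* a) ℕ.+ n ℕ.* b
  regroup = ℕ-solve-∀

-- Products of exponential generating functions

D : EGF → EGF
D a n = a (suc n)

egfMul-congˡ : ∀ {a a′ : EGF} (b : EGF) n → (∀ i → a i ≡ a′ i) → egfMul a b n ≡ egfMul a′ b n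
egfMul-congˡ b n a≗a′ =
  sumBelow-cong (suc n) (λ i _ → cong (λ u → + (n C i) * u * b (n ∸ i)) (a≗a′ i))

egfMul-congʳ : ∀ (a : EGF) {b b′ : EGF} n → (∀ i → b i ≡ b′ i) → egfMul a b n ≡ egfMul a b′ n
egfMul-congʳ a n b≗b′ =
  sumBelow-cong (suc n) (λ i _ → cong (λ v → + (n C i) * a i * v) (b≗b′ (n ∸ i)))

egfMul-*ˡ : ∀ (u : ℤ) (a b : EGF) n → egfMul (λ i → u * a i) b n ≡ u * egfMul a b n
egfMul-*ˡ u a b n =
  trans (sumBelow-cong (suc n) (λ i _ → reassoc (+ (n C i)) u (a i) (b (n ∸ i))))
        (sumBelow-*ˡ (suc n) u _)
  where
  reassoc : ∀ c u x y → c * (u * x) * y ≡ u * (c * x * y)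
  reassoc = solve-∀

egfMul-*ʳ : ∀ (u : ℤ) (a b : EGF) n → egfMul a (λ i → u * b i) n ≡ u * egfMul a b n
egfMul-*ʳ u a b n =
  trans (sumBelow-cong (suc n) (λ i _ → reassoc (+ (n C i)) u (a i) (b (n ∸ i))))
        (sumBelow-*ˡ (suc n) u _)
  where
  reassoc : ∀ c u x y → c * x * (u * y) ≡ u * (c * x * y)
  reassoc = solve-∀

egfMul--ˡ : ∀ (a a′ b : EGF) n → egfMul (λ i → a i - a′ i) b n ≡ egfMul a b n - egfMul a′ b n
egfMul--ˡ a a′ b n =
  trans (sumBelow-cong (suc n) (λ i _ → distrib (+ (n C i)) (a i) (a′ i) (b (n ∸ i))))
        (sumBelow-- (suc n) _ _)
  where
  distrib : ∀ c x x′ y → c * (x - x′) * y ≡ c * x * y - c * x′ * y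
  distrib = solve-∀

egfMul--ʳ : ∀ (a b b′ : EGF) n → egfMul a (λ i → b i - b′ i) n ≡ egfMul a b n - egfMul a b′ n
egfMul--ʳ a b b′ n =
  trans (sumBelow-cong (suc n) (λ i _ → distrib (+ (n C i)) (a i) (b (n ∸ i)) (b′ (n ∸ i))))
        (sumBelow-- (suc n) _ _)
  where
  distrib : ∀ c x y y′ → c * x * (y - y′) ≡ c * x * y - c * x * y′
  distrib = solve-∀

egfMul-zeroʳ : ∀ (a : EGF) n → egfMul a (λ _ → + 0) n ≡ + 0
egfMul-zeroʳ a n = sumBelow-zero (suc n) (λ i _ → ℤₚ.*-zeroʳ (+ (n C i) * a i))

egfMul-identityˡ : ∀ (b : EGF) n → egfMul egfOne b n ≡ b n
egfMul-identityˡ b n = begin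
  egfMul egfOne b n                                         ≡⟨ sumBelow-suc n _ ⟩
  + 1 * + 1 * b n + sumBelow n (λ i → + (n C suc i) * + 0 * b (n ∸ suc i))
    ≡⟨ cong₂ _+_ (ℤₚ.*-identityˡ (b n))
                 (sumBelow-zero n (λ i _ → zero-middle (+ (n C suc i)) (b (n ∸ suc i)))) ⟩
  b n + + 0                                                 ≡⟨ ℤₚ.+-identityʳ (b n) ⟩
  b n                                                       ∎
  where
  open ≡-Reasoning
  zero-middle : ∀ c y → c * + 0 * y ≡ + 0
  zero-middle = solve-∀

egfMul-Dʳ : ∀ (a b : EGF) n → egfMul a (D b) n ≡
  + (n C 0) * a 0 * b (suc n) + sumBelow (suc n) (λ i → + (n C suc i) * a (suc i) * b (n ∸ i))
egfMul-Dʳ a b n = begin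
  egfMul a (D b) n           ≡⟨ sumBelow-suc n _ ⟩
  h0 + sumBelow n g′         ≡⟨ cong (_+_ h0) (sumBelow-cong n g′≡g) ⟩
  h0 + sumBelow n g          ≡⟨ cong (_+_ h0) (sym (ℤₚ.+-identityʳ _)) ⟩
  h0 + (sumBelow n g + + 0)  ≡⟨ cong (λ z → h0 + (sumBelow n g + z)) (sym gn≡0) ⟩
  h0 + sumBelow (suc n) g    ∎
  where
  open ≡-Reasoning
  h0 = + (n C 0) * a 0 * b (suc n)
  g g′ : ℕ → ℤ
  g  i = + (n C suc i) * a (suc i) * b (n ∸ i)
  g′ i = + (n C suc i) * a (suc i) * b (suc (n ∸ suc i))
  g′≡g : ∀ i → i ℕ.< n → g′ i ≡ g i
  g′≡g i i<n = cong (λ j → + (n C suc i) * a (suc i) * b j) (sym (ℕₚ.+-∸-assoc 1 i<n))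
  gn≡0 : g n ≡ + 0
  gn≡0 rewrite k>n⇒nCk≡0 (ℕₚ.n<1+n n) = ℤₚ.*-zeroˡ (b (n ∸ n))

egfMul-leibniz : ∀ (a b : EGF) n → egfMul a b (suc n) ≡ egfMul (D a) b n + egfMul a (D b) n
egfMul-leibniz a b n = begin
  egfMul a b (suc n)
    ≡⟨ sumBelow-suc (suc n) _ ⟩
  h0 + sumBelow (suc n) (λ i → + (suc n C suc i) * a (suc i) * b (n ∸ i))
    ≡⟨ cong (_+_ h0) (sumBelow-cong (suc n) (λ i _ → pascal i)) ⟩
  h0 + sumBelow (suc n) (λ i → + (n C i) * a (suc i) * b (n ∸ i) + g i)
    ≡⟨ cong (_+_ h0) (sumBelow-+ (suc n) _ g) ⟩
  h0 + (egfMul (D a) b n + sumBelow (suc n) g)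
    ≡⟨ x∙yz≈y∙xz h0 (egfMul (D a) b n) (sumBelow (suc n) g) ⟩
  egfMul (D a) b n + (h0 + sumBelow (suc n) g)
    ≡⟨ cong (_+_ (egfMul (D a) b n)) (sym (egfMul-Dʳ a b n)) ⟩
  egfMul (D a) b n + egfMul a (D b) n ∎
  where
  open ≡-Reasoning
  h0 = + (suc n C 0) * a 0 * b (suc n)
  g : ℕ → ℤ
  g i = + (n C suc i) * a (suc i) * b (n ∸ i)
  pascal : ∀ i → + (suc n C suc i) * a (suc i) * b (n ∸ i) ≡ + (n C i) * a (suc i) * b (n ∸ i) + g i
  pascal i = begin
    + (suc n C suc i) * a (suc i) * b (n ∸ i)
      ≡⟨ cong (λ c → + c * a (suc i) * b (n ∸ i)) (sym (nCk+nC[k+1]≡[n+1]C[k+1] n i)) ⟩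
    + (n C i ℕ.+ n C suc i) * a (suc i) * b (n ∸ i)
      ≡⟨ cong (λ c → c * a (suc i) * b (n ∸ i)) (ℤₚ.pos-+ (n C i) (n C suc i)) ⟩
    (+ (n C i) + + (n C suc i)) * a (suc i) * b (n ∸ i)
      ≡⟨ distrib (+ (n C i)) (+ (n C suc i)) (a (suc i)) (b (n ∸ i)) ⟩
    + (n C i) * a (suc i) * b (n ∸ i) + g i ∎
    where
    distrib : ∀ c c′ x y → (c + c′) * x * y ≡ c * x * y + c′ * x * y
    distrib = solve-∀

-- e^{xt} e^{yt} = e^{(x+y)t}: coefficientwise, the binomial theorem.
egfMul-pow : ∀ (x y : ℤ) n → egfMul (x ^_) (y ^_) n ≡ (x + y) ^ n
egfMul-pow x y zero    = refl
egfMul-pow x y (suc n) = begin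
  egfMul (x ^_) (y ^_) (suc n)
    ≡⟨ egfMul-leibniz (x ^_) (y ^_) n ⟩
  egfMul (λ i → x * x ^ i) (y ^_) n + egfMul (x ^_) (λ i → y * y ^ i) n
    ≡⟨ cong₂ _+_ (egfMul-*ˡ x (x ^_) (y ^_) n) (egfMul-*ʳ y (x ^_) (y ^_) n) ⟩
  x * egfMul (x ^_) (y ^_) n + y * egfMul (x ^_) (y ^_) n
    ≡⟨ sym (ℤₚ.*-distribʳ-+ _ x y) ⟩
  (x + y) * egfMul (x ^_) (y ^_) n
    ≡⟨ cong ((x + y) *_) (egfMul-pow x y n) ⟩
  (x + y) ^ suc n ∎
  where open ≡-Reasoning

xPow : ℕ → EGF
xPow = egfPow oneMinusExpNeg

D-oneMinusExpNeg : ∀ i → D oneMinusExpNeg i ≡ egfOne i - oneMinusExpNeg i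
D-oneMinusExpNeg zero    = refl
D-oneMinusExpNeg (suc i) =
  trans (ℤₚ.-1*i≡-i (oneMinusExpNeg (suc i))) (sym (ℤₚ.+-identityˡ (- oneMinusExpNeg (suc i))))

xPow-suc-suc : ∀ m n → xPow (suc m) (suc n) ≡ + suc m * (xPow m n - xPow (suc m) n)
xPow-suc-suc m n = begin
  xPow (suc m) (suc n)
    ≡⟨ egfMul-leibniz oneMinusExpNeg (xPow m) n ⟩
  egfMul (D oneMinusExpNeg) (xPow m) n + egfMul oneMinusExpNeg (D (xPow m)) n
    ≡⟨ cong (_+ R) (egfMul-congˡ (xPow m) n D-oneMinusExpNeg) ⟩
  egfMul (λ i → egfOne i - oneMinusExpNeg i) (xPow m) n + egfMul oneMinusExpNeg (D (xPow m)) n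
    ≡⟨ cong (_+ R) (egfMul--ˡ egfOne oneMinusExpNeg (xPow m) n) ⟩
  (egfMul egfOne (xPow m) n - xPow (suc m) n) + egfMul oneMinusExpNeg (D (xPow m)) n
    ≡⟨ cong₂ _+_ (cong (_- xPow (suc m) n) (egfMul-identityˡ (xPow m) n)) (x*D[xPow] m) ⟩
  Δ + + m * Δ
    ≡⟨ sym (ℤₚ.suc-* (+ m) Δ) ⟩
  + suc m * Δ ∎
  where
  open ≡-Reasoning
  Δ = xPow m n - xPow (suc m) n
  R = egfMul oneMinusExpNeg (D (xPow m)) n
  x*D[xPow] : ∀ m → egfMul oneMinusExpNeg (D (xPow m)) n ≡ + m * (xPow m n - xPow (suc m) n)
  x*D[xPow] zero    = egfMul-zeroʳ oneMinusExpNeg n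
  x*D[xPow] (suc m) = begin
    egfMul oneMinusExpNeg (D (xPow (suc m))) n
      ≡⟨ egfMul-congʳ oneMinusExpNeg n (xPow-suc-suc m) ⟩
    egfMul oneMinusExpNeg (λ i → + suc m * (xPow m i - xPow (suc m) i)) n
      ≡⟨ egfMul-*ʳ (+ suc m) oneMinusExpNeg (λ i → xPow m i - xPow (suc m) i) n ⟩
    + suc m * egfMul oneMinusExpNeg (λ i → xPow m i - xPow (suc m) i) n
      ≡⟨ cong (+ suc m *_) (egfMul--ʳ oneMinusExpNeg (xPow m) (xPow (suc m)) n) ⟩
    + suc m * (xPow (suc m) n - xPow (suc (suc m)) n) ∎

xPow-vanish : ∀ {m n} → n ℕ.< m → xPow m n ≡ + 0
xPow-vanish {suc m} {zero}  _         = refl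
xPow-vanish {suc m} {suc n} (s≤s n<m) = begin
  xPow (suc m) (suc n)                  ≡⟨ xPow-suc-suc m n ⟩
  + suc m * (xPow m n - xPow (suc m) n) ≡⟨ cong₂ (λ u v → + suc m * (u - v)) (xPow-vanish n<m)
                                                  (xPow-vanish (ℕₚ.m<n⇒m<1+n n<m)) ⟩
  + suc m * + 0                         ≡⟨ ℤₚ.*-zeroʳ (+ suc m) ⟩
  + 0                                   ∎
  where open ≡-Reasoning

m∣xPow[m][n+1] : ∀ m n → + m ∣ xPow m (suc n)
m∣xPow[m][n+1] zero    n = divides (+ 0) refl
m∣xPow[m][n+1] (suc m) n =
  divides Δ (trans (xPow-suc-suc m n) (ℤₚ.*-comm (+ suc m) Δ))
  where Δ = xPow m n - xPow (suc m) n

xPow-summation-by-parts : ∀ (w : ℕ → ℤ) {n B} → n ℕ.< B →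
  sumBelow (suc B) (λ m → w m * xPow m (suc n)) ≡
  sumBelow B (λ m → (+ suc m * w (suc m) - + m * w m) * xPow m n)
xPow-summation-by-parts w {n} {B} n<B = begin
  sumBelow (suc B) (λ m → w m * xPow m (suc n))
    ≡⟨ sumBelow-suc B _ ⟩
  w 0 * + 0 + sumBelow B (λ m → w (suc m) * xPow (suc m) (suc n))
    ≡⟨ cong₂ _+_ (ℤₚ.*-zeroʳ (w 0)) (sumBelow-cong B (λ m _ → expand m)) ⟩
  + 0 + sumBelow B (λ m → f m - g (suc m))
    ≡⟨ ℤₚ.+-identityˡ _ ⟩
  sumBelow B (λ m → f m - g (suc m))
    ≡⟨ sumBelow-- B f (g ∘ suc) ⟩
  sumBelow B f - sumBelow B (g ∘ suc)
    ≡⟨ cong (λ z → sumBelow B f - z) (sumBelow-shift B g (ℤₚ.*-zeroˡ (xPow 0 n)) gB≡0) ⟩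
  sumBelow B f - sumBelow B g
    ≡⟨ sym (sumBelow-- B f g) ⟩
  sumBelow B (λ m → f m - g m)
    ≡⟨ sumBelow-cong B (λ m _ → sym ([y-z]x≈yx-zx (xPow m n) (+ suc m * w (suc m)) (+ m * w m))) ⟩
  sumBelow B (λ m → (+ suc m * w (suc m) - + m * w m) * xPow m n) ∎
  where
  open ≡-Reasoning
  f g : ℕ → ℤ
  f m = + suc m * w (suc m) * xPow m n
  g m = + m * w m * xPow m n
  expand : ∀ m → w (suc m) * xPow (suc m) (suc n) ≡ f m - g (suc m)
  expand m = trans (cong (w (suc m) *_) (xPow-suc-suc m n))
                   (distrib (w (suc m)) (+ suc m) (xPow m n) (xPow (suc m) n))
    where
    distrib : ∀ w c x y → w * (c * (x - y)) ≡ c * w * x - c * w * y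
    distrib = solve-∀
  gB≡0 : g B ≡ + 0
  gB≡0 = trans (cong (+ B * w B *_) (xPow-vanish n<B)) (ℤₚ.*-zeroʳ (+ B * w B))

-- Symmetry of B_n^{(-k)} in n and k

-- T k j = j! S(k+1, j+1), with S the Stirling numbers of the second kind.  The truncated
-- j ∸ 1 is harmless: at j = 0 its coefficient is 0.
T : ℕ → ℕ → ℤ
T zero    zero    = + 1
T zero    (suc j) = + 0
T (suc k) j       = + suc j * T k j + + j * T k (j ∸ 1)

[m+1]^k≡sum[mCj*Tkj] : ∀ m k {B} → m ℕ.< B → (+ suc m) ^ k ≡ sumBelow B (λ j → + (m C j) * T k j)
[m+1]^k≡sum[mCj*Tkj] m zero    {suc B} _ = sym (begin
  sumBelow (suc B) (λ j → + (m C j) * T 0 j)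
    ≡⟨ sumBelow-suc B _ ⟩
  + 1 + sumBelow B (λ j → + (m C suc j) * + 0)
    ≡⟨ cong (_+_ (+ 1)) (sumBelow-zero B (λ j _ → ℤₚ.*-zeroʳ (+ (m C suc j)))) ⟩
  + 1 ∎)
  where open ≡-Reasoning
[m+1]^k≡sum[mCj*Tkj] m (suc k) {B} m<B = sym (begin
  sumBelow B (λ j → + (m C j) * T (suc k) j)
    ≡⟨ sumBelow-cong B (λ j _ → ℤₚ.*-distribˡ-+ (+ (m C j)) _ _) ⟩
  sumBelow B (λ j → a j + h j)
    ≡⟨ sumBelow-+ B a h ⟩
  sumBelow B a + sumBelow B h
    ≡⟨ cong (_+_ (sumBelow B a)) (sym (sumBelow-shift B h (ℤₚ.*-zeroʳ (+ 1)) hB≡0)) ⟩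
  sumBelow B a + sumBelow B (h ∘ suc)
    ≡⟨ sym (sumBelow-+ B a (h ∘ suc)) ⟩
  sumBelow B (λ j → a j + h (suc j))
    ≡⟨ sumBelow-cong B (λ j _ → combine j) ⟩
  sumBelow B (λ j → + suc m * (+ (m C j) * T k j))
    ≡⟨ sumBelow-*ˡ B (+ suc m) _ ⟩
  + suc m * sumBelow B (λ j → + (m C j) * T k j)
    ≡⟨ cong (+ suc m *_) (sym ([m+1]^k≡sum[mCj*Tkj] m k m<B)) ⟩
  (+ suc m) ^ suc k ∎)
  where
  open ≡-Reasoning
  a h : ℕ → ℤ
  a j = + (m C j) * (+ suc j * T k j)
  h j = + (m C j) * (+ j * T k (j ∸ 1))
  hB≡0 : h B ≡ + 0
  hB≡0 rewrite k>n⇒nCk≡0 m<B = refl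
  combine : ∀ j → a j + h (suc j) ≡ + suc m * (+ (m C j) * T k j)
  combine j = begin
    a j + h (suc j)
      ≡⟨ regroup (+ (m C j)) (+ (m C suc j)) (+ suc j) (T k j) ⟩
    + suc j * (+ (m C j) + + (m C suc j)) * T k j
      ≡⟨ cong (λ z → z * T k j) (begin
           + suc j * (+ (m C j) + + (m C suc j))
             ≡⟨ cong (+ suc j *_) (sym (ℤₚ.pos-+ (m C j) (m C suc j))) ⟩
           + suc j * + (m C j ℕ.+ m C suc j)
             ≡⟨ sym (ℤₚ.pos-* (suc j) _) ⟩
           + (suc j ℕ.* (m C j ℕ.+ m C suc j))
             ≡⟨ cong +_ ([k+1]*[nCk+nC[k+1]]≡[n+1]*nCk m j) ⟩
           + (suc m ℕ.* (m C j))
             ≡⟨ ℤₚ.pos-* (suc m) (m C j) ⟩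
           + suc m * + (m C j) ∎) ⟩
    + suc m * + (m C j) * T k j
      ≡⟨ ℤₚ.*-assoc (+ suc m) (+ (m C j)) (T k j) ⟩
    + suc m * (+ (m C j) * T k j) ∎
    where
    regroup : ∀ c c′ s t → c * (s * t) + c′ * (s * t) ≡ s * (c + c′) * t
    regroup = solve-∀

sum[mCj*xPow[m][n]]≡Tnj : ∀ n j {B} → n ℕ.< B → sumBelow B (λ m → + (m C j) * xPow m n) ≡ T n j
sum[mCj*xPow[m][n]]≡Tnj zero    j {suc B} _ = begin
  sumBelow (suc B) (λ m → + (m C j) * xPow m 0)
    ≡⟨ sumBelow-suc B _ ⟩
  + (0 C j) * + 1 + sumBelow B (λ m → + (suc m C j) * + 0)
    ≡⟨ cong (_+_ (+ (0 C j) * + 1)) (sumBelow-zero B (λ m _ → ℤₚ.*-zeroʳ (+ (suc m C j)))) ⟩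
  + (0 C j) * + 1 + + 0
    ≡⟨ T0 j ⟩
  T 0 j ∎
  where
  open ≡-Reasoning
  T0 : ∀ j → + (0 C j) * + 1 + + 0 ≡ T 0 j
  T0 zero    = refl
  T0 (suc j) = refl
sum[mCj*xPow[m][n]]≡Tnj (suc n) j {suc B} (s≤s n<B) = begin
  sumBelow (suc B) (λ m → + (m C j) * xPow m (suc n))
    ≡⟨ xPow-summation-by-parts (λ m → + (m C j)) n<B ⟩
  sumBelow B (λ m → (+ suc m * + (suc m C j) - + m * + (m C j)) * xPow m n)
    ≡⟨ sumBelow-cong B (λ m _ → weights m) ⟩
  sumBelow B (λ m → + suc j * (+ (m C j) * xPow m n) + + j * (+ (m C (j ∸ 1)) * xPow m n))
    ≡⟨ sumBelow-+ B _ _ ⟩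
  sumBelow B (λ m → + suc j * (+ (m C j) * xPow m n))
    + sumBelow B (λ m → + j * (+ (m C (j ∸ 1)) * xPow m n))
    ≡⟨ cong₂ _+_ (sumBelow-*ˡ B (+ suc j) _) (sumBelow-*ˡ B (+ j) _) ⟩
  + suc j * sumBelow B (λ m → + (m C j) * xPow m n)
    + + j * sumBelow B (λ m → + (m C (j ∸ 1)) * xPow m n)
    ≡⟨ cong₂ (λ u v → + suc j * u + + j * v) (sum[mCj*xPow[m][n]]≡Tnj n j n<B)
                                              (sum[mCj*xPow[m][n]]≡Tnj n (j ∸ 1) n<B) ⟩
  T (suc n) j ∎
  where
  open ≡-Reasoning
  weights : ∀ m → (+ suc m * + (suc m C j) - + m * + (m C j)) * xPow m n ≡
                  + suc j * (+ (m C j) * xPow m n) + + j * (+ (m C (j ∸ 1)) * xPow m n)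
  weights m = begin
    (+ suc m * + (suc m C j) - + m * + (m C j)) * xPow m n
      ≡⟨ cong (λ z → (z - + m * + (m C j)) * xPow m n) (begin
           + suc m * + (suc m C j)
             ≡⟨ sym (ℤₚ.pos-* (suc m) (suc m C j)) ⟩
           + (suc m ℕ.* (suc m C j))
             ≡⟨ cong +_ ([n+1]*[n+1]Ck≡[k+1]*nCk+k*nC[k-1]+n*nCk m j) ⟩
           + ((suc j ℕ.* (m C j) ℕ.+ j ℕ.* (m C (j ∸ 1))) ℕ.+ m ℕ.* (m C j))
             ≡⟨ trans (ℤₚ.pos-+ _ (m ℕ.* (m C j)))
                      (cong₂ _+_ (trans (ℤₚ.pos-+ _ (j ℕ.* (m C (j ∸ 1))))
                                        (cong₂ _+_ (ℤₚ.pos-* (suc j) (m C j))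
                                                   (ℤₚ.pos-* j (m C (j ∸ 1)))))
                                 (ℤₚ.pos-* m (m C j))) ⟩
           (+ suc j * + (m C j) + + j * + (m C (j ∸ 1))) + + m * + (m C j) ∎) ⟩
    ((+ suc j * + (m C j) + + j * + (m C (j ∸ 1))) + + m * + (m C j) - + m * + (m C j)) * xPow m n
      ≡⟨ cancel (+ suc j) (+ j) (+ (m C j)) (+ (m C (j ∸ 1))) (+ m) (xPow m n) ⟩
    + suc j * (+ (m C j) * xPow m n) + + j * (+ (m C (j ∸ 1)) * xPow m n) ∎
    where
    cancel : ∀ s j c c′ m x → ((s * c + j * c′) + m * c - m * c) * x ≡ s * (c * x) + j * (c′ * x)
    cancel = solve-∀

polyBernoulliNeg≡sum[T*T] : ∀ k n {B} → n ℕ.< B →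
  polyBernoulliNeg k n ≡ sumBelow B (λ j → T k j * T n j)
polyBernoulliNeg≡sum[T*T] k n {B} n<B = begin
  sumBelow (suc n) (λ m → (+ suc m) ^ k * xPow m n)
    ≡⟨ sumBelow-cong (suc n) (λ m m<1+n → trans
         (cong (_* xPow m n) ([m+1]^k≡sum[mCj*Tkj] m k (ℕₚ.≤-trans m<1+n n<B)))
         (sym (sumBelow-*ʳ B (xPow m n) _))) ⟩
  sumBelow (suc n) (λ m → sumBelow B (λ j → + (m C j) * T k j * xPow m n))
    ≡⟨ sumBelow-comm (suc n) B _ ⟩
  sumBelow B (λ j → sumBelow (suc n) (λ m → + (m C j) * T k j * xPow m n))
    ≡⟨ sumBelow-cong B (λ j _ → begin
         sumBelow (suc n) (λ m → + (m C j) * T k j * xPow m n)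
           ≡⟨ sumBelow-cong (suc n) (λ m _ → swap (+ (m C j)) (T k j) (xPow m n)) ⟩
         sumBelow (suc n) (λ m → T k j * (+ (m C j) * xPow m n))
           ≡⟨ sumBelow-*ˡ (suc n) (T k j) _ ⟩
         T k j * sumBelow (suc n) (λ m → + (m C j) * xPow m n)
           ≡⟨ cong (T k j *_) (sum[mCj*xPow[m][n]]≡Tnj n j ℕₚ.≤-refl) ⟩
         T k j * T n j ∎) ⟩
  sumBelow B (λ j → T k j * T n j) ∎
  where
  open ≡-Reasoning
  swap : ∀ c t x → c * t * x ≡ t * (c * x)
  swap = solve-∀

polyBernoulliNeg-sym : ∀ k n → polyBernoulliNeg k n ≡ polyBernoulliNeg n k
polyBernoulliNeg-sym k n = begin
  polyBernoulliNeg k n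
    ≡⟨ polyBernoulliNeg≡sum[T*T] k n (s≤s (ℕₚ.m≤m+n n k)) ⟩
  sumBelow B (λ j → T k j * T n j)
    ≡⟨ sumBelow-cong B (λ j _ → ℤₚ.*-comm (T k j) (T n j)) ⟩
  sumBelow B (λ j → T n j * T k j)
    ≡⟨ sym (polyBernoulliNeg≡sum[T*T] n k (s≤s (ℕₚ.m≤n+m k n))) ⟩
  polyBernoulliNeg n k ∎
  where
  open ≡-Reasoning
  B = suc (n ℕ.+ k)

-- Euler's theorem for prime powers

prime∣pCj : ∀ {p j} → Prime p → 0 ℕ.< j → j ℕ.< p → p ℕ∣.∣ p C j
prime∣pCj {suc q} {suc i} p-prime _ (s≤s i<q)
  with euclidsLemma (suc i) (suc q C suc i) p-prime
         (ℕ∣.divides (q C i) (trans ([k+1]*[n+1]C[k+1]≡[n+1]*nCk q i) (ℕₚ.*-comm (suc q) (q C i))))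
... | inj₁ p∣1+i = ⊥-elim (ℕₚ.<⇒≱ (s≤s i<q) (ℕ∣.∣⇒≤ p∣1+i))
... | inj₂ p∣pCj = p∣pCj

prime∣[1+x]^p-x^p-1 : ∀ {p} → Prime p → ∀ (x : ℤ) → + p ∣ (+ 1 + x) ^ p - x ^ p - + 1
prime∣[1+x]^p-x^p-1 {zero}  p-prime x = ⊥-elim (¬prime[0] p-prime)
prime∣[1+x]^p-x^p-1 {suc q} p-prime x =
  subst (+ suc q ∣_) (sym expansion) (∣-sumBelow q (f ∘ suc) p∣middle)
  where
  open ≡-Reasoning
  f : ℕ → ℤ
  f i = + (suc q C i) * (+ 1) ^ i * x ^ (suc q ∸ i)
  first : f 0 ≡ x ^ suc q
  first = ℤₚ.*-identityˡ (x ^ suc q)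
  last : f (suc q) ≡ + 1
  last rewrite nCn≡1 (suc q) | ℤₚ.^-zeroˡ (suc q) | ℕₚ.n∸n≡0 q = refl
  expansion : (+ 1 + x) ^ suc q - x ^ suc q - + 1 ≡ sumBelow q (f ∘ suc)
  expansion = begin
    (+ 1 + x) ^ suc q - x ^ suc q - + 1
      ≡⟨ cong (λ z → z - x ^ suc q - + 1) (sym (egfMul-pow (+ 1) x (suc q))) ⟩
    sumBelow (suc (suc q)) f - x ^ suc q - + 1
      ≡⟨ cong (λ z → z - x ^ suc q - + 1) (sumBelow-suc (suc q) f) ⟩
    f 0 + (sumBelow q (f ∘ suc) + f (suc q)) - x ^ suc q - + 1
      ≡⟨ cong₂ (λ u v → u + (sumBelow q (f ∘ suc) + v) - x ^ suc q - + 1) first last ⟩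
    x ^ suc q + (sumBelow q (f ∘ suc) + + 1) - x ^ suc q - + 1
      ≡⟨ cancel (x ^ suc q) (sumBelow q (f ∘ suc)) ⟩
    sumBelow q (f ∘ suc) ∎
    where
    cancel : ∀ a s → a + (s + + 1) - a - + 1 ≡ s
    cancel = solve-∀
  p∣middle : ∀ i → i ℕ.< q → + suc q ∣ f (suc i)
  p∣middle i i<q = ∣m⇒∣m*n (x ^ (q ∸ i)) (∣m⇒∣m*n ((+ 1) ^ suc i)
    (∣ᵤ⇒∣ {+ suc q} {+ (suc q C suc i)} (prime∣pCj p-prime (s≤s z≤n) (s≤s i<q))))

prime∣a^p-a : ∀ {p} → Prime p → ∀ a → + p ∣ (+ a) ^ p - + a
prime∣a^p-a {zero}  p-prime a       = ⊥-elim (¬prime[0] p-prime)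
prime∣a^p-a {suc q} p-prime zero    = divides (+ 0) refl
prime∣a^p-a {suc q} p-prime (suc a) =
  subst (+ suc q ∣_) (regroup ((+ 1 + + a) ^ suc q) ((+ a) ^ suc q) (+ a))
        (∣m∣n⇒∣m+n (prime∣[1+x]^p-x^p-1 p-prime (+ a)) (prime∣a^p-a p-prime a))
  where
  regroup : ∀ y z x → y - z - + 1 + (z - x) ≡ y - (+ 1 + x)
  regroup = solve-∀

prime∣a^[p-1]-1 : ∀ {p a} → Prime p → ¬ p ℕ∣.∣ a → + p ∣ (+ a) ^ (p ∸ 1) - + 1
prime∣a^[p-1]-1 {zero}      p-prime p∤a = ⊥-elim (¬prime[0] p-prime)
prime∣a^[p-1]-1 {suc q} {a} p-prime p∤a =
  ∣ᵤ⇒∣ (fromInj₂ (⊥-elim ∘ p∤a) (euclidsLemma a ∣ r ∣ p-prime p∣a*r))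
  where
  r = (+ a) ^ q - + 1
  factor : ∀ a t → a * t - a ≡ a * (t - + 1)
  factor = solve-∀
  p∣a*r : suc q ℕ∣.∣ a ℕ.* ∣ r ∣
  p∣a*r = subst (suc q ℕ∣.∣_) (ℤₚ.abs-* (+ a) r)
            (∣⇒∣ᵤ (subst (+ suc q ∣_) (factor (+ a) ((+ a) ^ q)) (prime∣a^p-a p-prime a)))

*-pres-∣ : ∀ {a b c d : ℤ} → a ∣ b → c ∣ d → a * c ∣ b * d
*-pres-∣ {b = b} {c = c} a∣b c∣d = ∣-trans (*-monoˡ-∣ c a∣b) (*-monoʳ-∣ b c∣d)

geometric-sum : ∀ (y : ℤ) L → (y - + 1) * sumBelow L (y ^_) ≡ y ^ L - + 1
geometric-sum y zero    = ℤₚ.*-zeroʳ (y - + 1)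
geometric-sum y (suc L) = begin
  (y - + 1) * (sumBelow L (y ^_) + y ^ L)
    ≡⟨ ℤₚ.*-distribˡ-+ (y - + 1) (sumBelow L (y ^_)) (y ^ L) ⟩
  (y - + 1) * sumBelow L (y ^_) + (y - + 1) * y ^ L
    ≡⟨ cong (_+ (y - + 1) * y ^ L) (geometric-sum y L) ⟩
  (y ^ L - + 1) + (y - + 1) * y ^ L
    ≡⟨ telescope y (y ^ L) ⟩
  y * y ^ L - + 1 ∎
  where
  open ≡-Reasoning
  telescope : ∀ y t → (t - + 1) + (y - + 1) * t ≡ y * t - + 1
  telescope = solve-∀

y-1∣y^i-1 : ∀ (y : ℤ) i → y - + 1 ∣ y ^ i - + 1
y-1∣y^i-1 y i = divides (sumBelow i (y ^_)) (trans (sym (geometric-sum y i)) (ℤₚ.*-comm (y - + 1) _))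

p∣d∣y-1⇒dp∣y^p-1 : ∀ {p} {d y : ℤ} → + p ∣ d → d ∣ y - + 1 → d * + p ∣ y ^ p - + 1
p∣d∣y-1⇒dp∣y^p-1 {p} {d} {y} p∣d d∣y-1 =
  subst (d * + p ∣_) (geometric-sum y p) (*-pres-∣ d∣y-1 p∣sum)
  where
  open ≡-Reasoning
  split : sumBelow p (y ^_) ≡ sumBelow p (λ i → y ^ i - + 1) + + p * + 1
  split = begin
    sumBelow p (y ^_)
      ≡⟨ sumBelow-cong p (λ i _ → minus-plus (y ^ i)) ⟩
    sumBelow p (λ i → (y ^ i - + 1) + + 1)
      ≡⟨ sumBelow-+ p _ (λ _ → + 1) ⟩
    sumBelow p (λ i → y ^ i - + 1) + sumBelow p (λ _ → + 1)
      ≡⟨ cong (_+_ (sumBelow p (λ i → y ^ i - + 1))) (sumBelow-const p (+ 1)) ⟩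
    sumBelow p (λ i → y ^ i - + 1) + + p * + 1 ∎
    where
    minus-plus : ∀ t → t ≡ (t - + 1) + + 1
    minus-plus = solve-∀
  p∣sum : + p ∣ sumBelow p (y ^_)
  p∣sum = subst (+ p ∣_) (sym split)
    (∣m∣n⇒∣m+n (∣-sumBelow p _ (λ i _ → ∣-trans p∣d (∣-trans d∣y-1 (y-1∣y^i-1 y i))))
               (∣m⇒∣m*n (+ 1) ∣-refl))

p^[N+1]∣a^φ[p^[N+1]]-1 : ∀ {p a} → Prime p → ¬ p ℕ∣.∣ a → ∀ N →
                          + (p ℕ.^ suc N) ∣ (+ a) ^ φPrimePow p (suc N) - + 1
p^[N+1]∣a^φ[p^[N+1]]-1 {p} {a} p-prime p∤a zero =
  subst₂ (λ d e → d ∣ (+ a) ^ e - + 1) (cong +_ (sym (ℕₚ.*-identityʳ p)))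
         (sym (ℕₚ.*-identityˡ (p ∸ 1))) (prime∣a^[p-1]-1 p-prime p∤a)
p^[N+1]∣a^φ[p^[N+1]]-1 {p} {a} p-prime p∤a (suc N) =
  subst₂ (λ d z → d ∣ z - + 1) modulus power
    (p∣d∣y-1⇒dp∣y^p-1 (∣ᵤ⇒∣ {+ p} {+ (p ℕ.^ suc N)} (ℕ∣.m∣m*n (p ℕ.^ N)))
                      (p^[N+1]∣a^φ[p^[N+1]]-1 p-prime p∤a N))
  where
  e = φPrimePow p (suc N)
  modulus : + (p ℕ.^ suc N) * + p ≡ + (p ℕ.^ suc (suc N))
  modulus = trans (sym (ℤₚ.pos-* (p ℕ.^ suc N) p)) (cong +_ (ℕₚ.*-comm (p ℕ.^ suc N) p))
  power : ((+ a) ^ e) ^ p ≡ (+ a) ^ φPrimePow p (suc (suc N))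
  power = trans (ℤₚ.^-*-assoc (+ a) e p) (cong ((+ a) ^_) (reorder (p ℕ.^ N) (p ∸ 1) p))
    where
    reorder : ∀ q r p → q ℕ.* r ℕ.* p ≡ p ℕ.* q ℕ.* r
    reorder = ℕ-solve-∀

p∣y⇒p^N∣y^N : ∀ {p} {y : ℤ} → + p ∣ y → ∀ N → + (p ℕ.^ N) ∣ y ^ N
p∣y⇒p^N∣y^N         p∣y zero    = ∣-refl
p∣y⇒p^N∣y^N {p} {y} p∣y (suc N) =
  subst (_∣ y ^ suc N) (sym (ℤₚ.pos-* p (p ℕ.^ N))) (*-pres-∣ p∣y (p∣y⇒p^N∣y^N p∣y N))

y^m∣y^n : ∀ (y : ℤ) {m n} → m ℕ.≤ n → y ^ m ∣ y ^ n
y^m∣y^n y {m} {n} m≤n =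
  subst (y ^ m ∣_)
        (trans (sym (ℤₚ.^-distribˡ-+-* y m (n ∸ m))) (cong (y ^_) (ℕₚ.m+[n∸m]≡n m≤n)))
        (∣m⇒∣m*n (y ^ (n ∸ m)) ∣-refl)

p^N∣m*sum[[m+1]^[n+i]] : ∀ {p N n} → Prime p → 1 ℕ.≤ N → N ℕ.≤ n → ∀ m →
  + (p ℕ.^ N) ∣ + m * sumBelow (φPrimePow p N) (λ i → (+ suc m) ^ (n ℕ.+ i))
p^N∣m*sum[[m+1]^[n+i]] {p} {suc N} {n} p-prime _ N≤n m =
  subst (+ (p ℕ.^ suc N) ∣_) (sym factor) p^N∣y^n[y^L-1]
  where
  open ≡-Reasoning
  y = + suc m
  L = φPrimePow p (suc N)
  m≡y-1 : ∀ m → m ≡ (+ 1 + m) - + 1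
  m≡y-1 = solve-∀
  factor : + m * sumBelow L (λ i → y ^ (n ℕ.+ i)) ≡ y ^ n * (y ^ L - + 1)
  factor = begin
    + m * sumBelow L (λ i → y ^ (n ℕ.+ i))
      ≡⟨ cong₂ _*_ (m≡y-1 (+ m)) (sumBelow-cong L (λ i _ → ℤₚ.^-distribˡ-+-* y n i)) ⟩
    (y - + 1) * sumBelow L (λ i → y ^ n * y ^ i)
      ≡⟨ cong ((y - + 1) *_) (sumBelow-*ˡ L (y ^ n) (y ^_)) ⟩
    (y - + 1) * (y ^ n * sumBelow L (y ^_))
      ≡⟨ *-Comm.x∙yz≈y∙xz (y - + 1) (y ^ n) (sumBelow L (y ^_)) ⟩
    y ^ n * ((y - + 1) * sumBelow L (y ^_))
      ≡⟨ cong (y ^ n *_) (geometric-sum y L) ⟩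
    y ^ n * (y ^ L - + 1) ∎
  p^N∣y^n[y^L-1] : + (p ℕ.^ suc N) ∣ y ^ n * (y ^ L - + 1)
  p^N∣y^n[y^L-1] with p ℕ∣.∣? suc m
  ... | yes p∣y = ∣m⇒∣m*n (y ^ L - + 1)
                    (∣-trans (p∣y⇒p^N∣y^N (∣ᵤ⇒∣ {+ p} {y} p∣y) (suc N)) (y^m∣y^n y N≤n))
  ... | no  p∤y = ∣n⇒∣m*n (y ^ n) (p^[N+1]∣a^φ[p^[N+1]]-1 p-prime p∤y N)

sum[B[n+i,k]]≡sum[xPow*sum[[m+1]^[n+i]]] : ∀ L n k →
  sumBelow L (λ i → polyBernoulliNeg (n ℕ.+ i) k) ≡
  sumBelow (suc k) (λ m → xPow m k * sumBelow L (λ i → (+ suc m) ^ (n ℕ.+ i)))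
sum[B[n+i,k]]≡sum[xPow*sum[[m+1]^[n+i]]] L n k =
  trans (sumBelow-comm L (suc k) (λ i m → (+ suc m) ^ (n ℕ.+ i) * xPow m k))
        (sumBelow-cong (suc k) (λ m _ →
          trans (sumBelow-*ʳ L (xPow m k) _) (ℤₚ.*-comm _ (xPow m k))))

p^N∣sum[B[n+i,k]] : ∀ {p k N n} → Prime p → 1 ℕ.≤ k → 1 ℕ.≤ N → N ℕ.≤ n →
  + (p ℕ.^ N) ∣ sumBelow (φPrimePow p N) (λ i → polyBernoulliNeg (n ℕ.+ i) k)
p^N∣sum[B[n+i,k]] {p} {suc k} {N} {n} p-prime _ 1≤N N≤n =
  subst (+ (p ℕ.^ N) ∣_) (sym (sum[B[n+i,k]]≡sum[xPow*sum[[m+1]^[n+i]]] L n (suc k)))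
    (∣-sumBelow (suc (suc k)) _ (λ m _ →
      ∣-trans (p^N∣m*sum[[m+1]^[n+i]] p-prime 1≤N N≤n m)
              (*-monoˡ-∣ (sumBelow L (λ i → (+ suc m) ^ (n ℕ.+ i))) (m∣xPow[m][n+1] m k))))
  where L = φPrimePow p N

theorem3p6 : (p k N n : ℕ) → Prime p → 1 ℕ.≤ k → 1 ℕ.≤ N → N ℕ.≤ n →
    ((+ (p ℕ.^ N)) ∣ᵤ sumBelow (φPrimePow p N) (λ i → polyBernoulliNeg k (n ℕ.+ i)))
    × ((+ (p ℕ.^ N)) ∣ᵤ sumBelow (φPrimePow p N) (λ i → polyBernoulliNeg (n ℕ.+ i) k))
theorem3p6 p k N n p-prime 1≤k 1≤N N≤n =
    ∣⇒∣ᵤ (subst (+ (p ℕ.^ N) ∣_)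
                (sumBelow-cong L (λ i _ → polyBernoulliNeg-sym (n ℕ.+ i) k)) upper)
  , ∣⇒∣ᵤ upper
  where
  L = φPrimePow p N
  upper : + (p ℕ.^ N) ∣ sumBelow L (λ i → polyBernoulliNeg (n ℕ.+ i) k)
  upper = p^N∣sum[B[n+i,k]] p-prime 1≤k 1≤N N≤n
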